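{- Let $n$ be a nonnegative integer divisible by $12^3$ such that $s_2(n)=s_3(n)$. Then $$\{1,2,5,7,10,11\}\subseteq\{\ell_{12}((n+1)!),\ell_{12}((n+2)!),\dots,\ell_{12}((n+10)!)\}.$$
   Context: For an integer $b\ge2$ and a nonnegative integer $n=\sum_{j\ge0}a_jb^j$ with digits $a_j\in\{0,\dots,b-1\}$, $s_b(n)=\sum_j a_j$. For a positive integer $m$, write $m=12^{v}m'$ with $12\nmid m'$; then $\ell_{12}(m)\in\{1,\dots,11\}$ denotes the last nonzero digit of $m$ in base $12$, i.e. the residue of $m'$ modulo $12$. -}

module Defs where

open import Data.Nat using (ℕ; zero; suc; _+_; _*_; _≡ᵇ_; NonZero)
open import Data.Nat.DivMod using (_/_; _%_)
open import Data.Bool using (if_then_else_)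

-- Digit sum s_b(n) for base b (intended b ≥ 2), computed by repeated
-- division; the fuel argument bounds the number of digits (fuel = n suffices
-- since n / b < n for n > 0 and b ≥ 2).
digitSumFuel : (b : ℕ) → .{{_ : NonZero b}} → ℕ → ℕ → ℕ
digitSumFuel b zero    n = 0
digitSumFuel b (suc f) n = n % b + digitSumFuel b f (n / b)

s : (b : ℕ) → .{{_ : NonZero b}} → ℕ → ℕ
s b n = digitSumFuel b n n

-- Strip all factors of 12 (fuel = m suffices for m > 0), then take the
-- residue mod 12: the last nonzero base-12 digit of m (for m > 0).
strip12 : ℕ → ℕ → ℕ
strip12 zero    m = m
strip12 (suc f) m = if (m % 12) ≡ᵇ 0 then strip12 f (m / 12) else m

ℓ12 : ℕ → ℕ
ℓ12 m = strip12 m m % 12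

-- By Legendre's formula (p − 1)·v_p(m!) = m − s_p(m), the hypothesis s₂(n) = s₃(n) gives
-- v₂(n!) = 2·v₃(n!), so n! = 12^t·u with u prime to 6, i.e. u ≡ 1, 5, 7 or 11 (mod 12).
-- Since 12³ ∣ n, every factor n + j with 1 ≤ j ≤ 10 is e·(c + 12m) where e·c = j and e ∣ 144.
-- Hence (n + k)! = 12^(t + v₁₂(k!))·w with w ≡ u·k!/12^v₁₂(k!) (mod 12). For k = 1, 2, 5, 6, 7, 10
-- these quotients are 1, 2, 10, 5, 35, 175, i.e. 1, 2, 10, 5, 11, 7 modulo 12, and multiplying this
-- set by a unit of ℤ/12 permutes it.
module Submission where

open import Defs
open import Data.Nat using (ℕ; _+_; _^_; _≤_; _!)
open import Data.Nat.Divisibility using (_∣_)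
open import Data.Product using (∃; _×_)
open import Data.List using (List; _∷_; [])
open import Data.List.Relation.Unary.All using (All)
open import Relation.Binary.PropositionalEquality using (_≡_)

open import Data.Bool using (if_then_else_)
open import Data.List.Membership.Propositional using (find)
open import Data.List.Relation.Unary.All using (_∷_; []; all?; lookup) renaming (map to All-map)
open import Data.List.Relation.Unary.Any using (Any; any?)
open import Data.Nat
open import Data.Nat.DivMod
open import Data.Nat.Divisibility
open import Data.Nat.Induction using (<-wellFounded)
open import Data.Nat.Primality using (Prime; euclidsLemma; prime?; prime[2]; ¬prime[1]; prime⇒nonZero)
open import Data.Nat.Properties
open import Data.Nat.Tactic.RingSolver using (solve-∀)
open import Data.Product using (∃₂; _,_)
open import Data.Sum using (inj₁; inj₂)
open import Function using (_∘_)
open import Induction.WellFounded using (Acc; acc)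
open import Relation.Binary.PropositionalEquality
open import Relation.Nullary using (contradiction; Dec)
open import Relation.Nullary.Decidable using (from-yes; from-no; ¬?; _×-dec_; _→-dec_)

-- The base is written 2 + k so that b ≥ 2 holds by construction and b − 1 is suc k.
module Radix (k : ℕ) where

  b : ℕ
  b = 2 + k

  /b-≤ : ∀ {n f} → n ≤ suc f → n / b ≤ f
  /b-≤ {zero}  _   = z≤n
  /b-≤ {suc n} n≤f = <⇒≤pred (<-≤-trans (m/n<m (suc n) b (s≤s (s≤s z≤n))) n≤f)

  digitSumFuel-0 : ∀ f → digitSumFuel b f 0 ≡ 0
  digitSumFuel-0 zero    = refl
  digitSumFuel-0 (suc f) = digitSumFuel-0 f

  digitSumFuel-irrelevant : ∀ {f g} n → n ≤ f → n ≤ g → digitSumFuel b f n ≡ digitSumFuel b g n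
  digitSumFuel-irrelevant {zero}  {g}     .0 z≤n _   = sym (digitSumFuel-0 g)
  digitSumFuel-irrelevant {suc f} {zero}  .0 _   z≤n = digitSumFuel-0 (suc f)
  digitSumFuel-irrelevant {suc f} {suc g} n  n≤f n≤g =
    cong (n % b +_) (digitSumFuel-irrelevant (n / b) (/b-≤ n≤f) (/b-≤ n≤g))

  s-unfold : ∀ m → s b m ≡ m % b + s b (m / b)
  s-unfold zero    = refl
  s-unfold (suc m) = cong (suc m % b +_) (digitSumFuel-irrelevant {m} {suc m / b} _ (/b-≤ ≤-refl) ≤-refl)

  [r+q*b]%b≡r : ∀ {r} q → r < b → (r + q * b) % b ≡ r
  [r+q*b]%b≡r {r} q r<b = trans ([m+kn]%n≡m%n r q b) (m<n⇒m%n≡m r<b)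

  [r+q*b]/b≡q : ∀ {r} q → r < b → (r + q * b) / b ≡ q
  [r+q*b]/b≡q {r} q r<b = begin
    (r + q * b) / b     ≡⟨ +-distrib-/-∣ʳ r (n∣m*n q) ⟩
    r / b + q * b / b   ≡⟨ cong₂ _+_ (m<n⇒m/n≡0 r<b) (m*n/n≡m q b) ⟩
    q                   ∎
    where open ≡-Reasoning

  s-digit : ∀ {r} q → r < b → s b (r + q * b) ≡ r + s b q
  s-digit {r} q r<b = begin
    s b (r + q * b)                            ≡⟨ s-unfold (r + q * b) ⟩
    (r + q * b) % b + s b ((r + q * b) / b)    ≡⟨ cong₂ _+_ ([r+q*b]%b≡r q r<b) (cong (s b) ([r+q*b]/b≡q q r<b)) ⟩
    r + s b q                                  ∎
    where open ≡-Reasoning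

  data LastDigit : ℕ → Set where
    digit : ∀ r q → r < b → LastDigit (r + q * b)

  lastDigit : ∀ m → LastDigit m
  lastDigit m = subst LastDigit (sym (m≡m%n+[m/n]*n m b)) (digit (m % b) (m / b) (m%n<n m b))

  -- e is the number of carries when adding 1 to m in base b.
  carry : ∀ m → Acc _<_ m →
          ∃₂ λ e w → suc m ≡ b ^ e * w × b ∤ w × s b (suc m) + suc k * e ≡ suc (s b m)
  carry m _ with lastDigit m
  carry .(r + q * b) (acc rec) | digit r q r<b with m≤n⇒m<n∨m≡n (s≤s⁻¹ r<b)
  ... | inj₁ r<1+k = 0 , suc (r + q * b) , sym (*-identityˡ _) , b∤ , digits
    where
    b∤ : b ∤ suc (r + q * b)
    b∤ b∣ = 0≢1+n (trans (sym (n∣m⇒m%n≡0 _ b b∣)) ([r+q*b]%b≡r q (s≤s r<1+k)))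
    digits : s b (suc r + q * b) + suc k * 0 ≡ suc (s b (r + q * b))
    digits = begin
      s b (suc r + q * b) + suc k * 0   ≡⟨ cong (s b (suc r + q * b) +_) (*-zeroʳ (suc k)) ⟩
      s b (suc r + q * b) + 0           ≡⟨ +-identityʳ _ ⟩
      s b (suc r + q * b)               ≡⟨ s-digit q (s≤s r<1+k) ⟩
      suc (r + s b q)                   ≡⟨ cong suc (s-digit q r<b) ⟨
      suc (s b (r + q * b))             ∎
      where open ≡-Reasoning
  ... | inj₂ refl with carry q (rec q<m)
    where
    q<m : q < suc k + q * b
    q<m = ≤-<-trans (m≤m*n q b) (m<n+m (q * b) z<s)
  ... | e , w , 1+q≡ , b∤w , digits-q = suc e , w , 1+m≡ , b∤w , digits
    where
    1+m≡ : suc q * b ≡ b * b ^ e * w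
    1+m≡ = begin
      suc q * b         ≡⟨ cong (_* b) 1+q≡ ⟩
      b ^ e * w * b     ≡⟨ *-comm (b ^ e * w) b ⟩
      b * (b ^ e * w)   ≡⟨ *-assoc b (b ^ e) w ⟨
      b * b ^ e * w     ∎
      where open ≡-Reasoning
    rearrange : ∀ x c e → x + c * suc e ≡ c + (x + c * e)
    rearrange = solve-∀
    digits : s b (suc q * b) + suc k * suc e ≡ suc (s b (suc k + q * b))
    digits = begin
      s b (suc q * b) + suc k * suc e   ≡⟨ cong (_+ suc k * suc e) (s-digit (suc q) z<s) ⟩
      s b (suc q) + suc k * suc e       ≡⟨ rearrange (s b (suc q)) (suc k) e ⟩
      suc k + (s b (suc q) + suc k * e) ≡⟨ cong (suc k +_) digits-q ⟩
      suc k + suc (s b q)               ≡⟨ +-suc (suc k) (s b q) ⟩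
      suc (suc k + s b q)               ≡⟨ cong suc (s-digit q ≤-refl) ⟨
      suc (s b (suc k + q * b))         ∎
      where open ≡-Reasoning

  legendre : Prime b → ∀ m → ∃₂ λ E U → m ! ≡ b ^ E * U × b ∤ U × suc k * E + s b m ≡ m
  legendre _ zero = 0 , 1 , refl , b≢1 ∘ ∣1⇒≡1 , cong (_+ 0) (*-zeroʳ (suc k))
    where
    b≢1 : b ≢ 1
    b≢1 ()
  legendre b-prime (suc m) with carry m (<-wellFounded m) | legendre b-prime m
  ... | e , w , 1+m≡ , b∤w , digits | E , U , m!≡ , b∤U , legendre-m =
    e + E , w * U , 1+m!≡ , b∤wU , legendre-1+m
    where
    1+m!≡ : suc m ! ≡ b ^ (e + E) * (w * U)
    1+m!≡ = begin
      suc m * m !                 ≡⟨ cong₂ _*_ 1+m≡ m!≡ ⟩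
      b ^ e * w * (b ^ E * U)     ≡⟨ interchange (b ^ e) w (b ^ E) U ⟩
      b ^ e * b ^ E * (w * U)     ≡⟨ cong (_* (w * U)) (^-distribˡ-+-* b e E) ⟨
      b ^ (e + E) * (w * U)       ∎
      where
      open ≡-Reasoning
      interchange : ∀ x y z u → x * y * (z * u) ≡ x * z * (y * u)
      interchange = solve-∀
    b∤wU : b ∤ w * U
    b∤wU b∣wU with euclidsLemma w U b-prime b∣wU
    ... | inj₁ b∣w = b∤w b∣w
    ... | inj₂ b∣U = b∤U b∣U
    legendre-1+m : suc k * (e + E) + s b (suc m) ≡ suc m
    legendre-1+m = begin
      suc k * (e + E) + s b (suc m)         ≡⟨ rearrange (suc k) e E (s b (suc m)) ⟩
      (s b (suc m) + suc k * e) + suc k * E ≡⟨ cong (_+ suc k * E) digits ⟩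
      suc (s b m + suc k * E)               ≡⟨ cong suc (+-comm (s b m) (suc k * E)) ⟩
      suc (suc k * E + s b m)               ≡⟨ cong suc legendre-m ⟩
      suc m                                 ∎
      where
      open ≡-Reasoning
      rearrange : ∀ c e E x → c * (e + E) + x ≡ (x + c * e) + c * E
      rearrange = solve-∀

^-distribʳ-* : ∀ m n o → (m * n) ^ o ≡ m ^ o * n ^ o
^-distribʳ-* m n zero    = refl
^-distribʳ-* m n (suc o) = trans (cong (m * n *_) (^-distribʳ-* m n o)) (interchange m n (m ^ o) (n ^ o))
  where
  interchange : ∀ x y z u → x * y * (z * u) ≡ x * z * (y * u)
  interchange = solve-∀

prime∤⇒∤^ : ∀ {p a} → Prime p → p ∤ a → ∀ n → p ∤ a ^ n
prime∤⇒∤^ p-prime p∤a zero    p∣1 = ¬prime[1] (subst Prime (∣1⇒≡1 p∣1) p-prime)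
prime∤⇒∤^ p-prime p∤a (suc n) p∣a*aⁿ with euclidsLemma _ _ p-prime p∣a*aⁿ
... | inj₁ p∣a  = p∤a p∣a
... | inj₂ p∣aⁿ = prime∤⇒∤^ p-prime p∤a n p∣aⁿ

prime^∣-cancelˡ : ∀ {p a} → Prime p → p ∤ a → ∀ n {m} → p ^ n ∣ a * m → p ^ n ∣ m
prime^∣-cancelˡ p-prime p∤a zero    _ = 1∣ _
prime^∣-cancelˡ {p} {a} p-prime p∤a (suc n) {m} pⁿ⁺¹∣am
  with euclidsLemma a m p-prime (∣-trans (m∣m*n (p ^ n)) pⁿ⁺¹∣am)
... | inj₁ p∣a = contradiction p∣a p∤a
... | inj₂ (divides m′ refl) = subst (p ^ suc n ∣_) (*-comm p m′) (*-monoʳ-∣ p pⁿ∣m′)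
  where
  instance
    p≢0 : NonZero p
    p≢0 = prime⇒nonZero p-prime
  shuffle : a * (m′ * p) ≡ p * (a * m′)
  shuffle = trans (sym (*-assoc a m′ p)) (*-comm (a * m′) p)
  pⁿ∣m′ : p ^ n ∣ m′
  pⁿ∣m′ = prime^∣-cancelˡ p-prime p∤a n (*-cancelˡ-∣ p (subst (p ^ suc n ∣_) shuffle pⁿ⁺¹∣am))

prime[3] : Prime 3
prime[3] = from-yes (prime? 3)

12^≡2^2*3^ : ∀ t → 12 ^ t ≡ 2 ^ (2 * t) * 3 ^ t
12^≡2^2*3^ t = trans (^-distribʳ-* 4 3 t) (cong (_* 3 ^ t) (^-*-assoc 2 2 t))

12-adic-from-valuations : ∀ {N t U₂ U₃} → N ≡ 2 ^ (2 * t) * U₂ → N ≡ 3 ^ t * U₃ → 2 ∤ U₂ → 3 ∤ U₃ →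
                          ∃ λ u → N ≡ 12 ^ t * u × 2 ∤ u × 3 ∤ u
12-adic-from-valuations {N} {t} {U₃ = U₃} N≡2^2t*U₂ N≡3^t*U₃ 2∤U₂ 3∤U₃
  with prime^∣-cancelˡ prime[3] (prime∤⇒∤^ prime[3] (from-no (3 ∣? 2)) (2 * t)) t
         (subst (3 ^ t ∣_) (trans (sym N≡3^t*U₃) N≡2^2t*U₂) (m∣m*n _))
... | divides u refl = u , N≡12^t*u , 2∤u , 3∤u
  where
  N≡12^t*u : N ≡ 12 ^ t * u
  N≡12^t*u = begin
    N                           ≡⟨ N≡2^2t*U₂ ⟩
    2 ^ (2 * t) * (u * 3 ^ t)   ≡⟨ shuffle (2 ^ (2 * t)) u (3 ^ t) ⟩
    2 ^ (2 * t) * 3 ^ t * u     ≡⟨ cong (_* u) (12^≡2^2*3^ t) ⟨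
    12 ^ t * u                  ∎
    where
    open ≡-Reasoning
    shuffle : ∀ x y z → x * (y * z) ≡ x * z * y
    shuffle = solve-∀
  U₃≡ : U₃ ≡ 2 ^ (2 * t) * u
  U₃≡ = *-cancelˡ-≡ U₃ _ (3 ^ t) {{m^n≢0 3 t}} (begin
    3 ^ t * U₃                  ≡⟨ trans (sym N≡3^t*U₃) N≡12^t*u ⟩
    12 ^ t * u                  ≡⟨ cong (_* u) (trans (12^≡2^2*3^ t) (*-comm _ (3 ^ t))) ⟩
    3 ^ t * 2 ^ (2 * t) * u     ≡⟨ *-assoc (3 ^ t) _ u ⟩
    3 ^ t * (2 ^ (2 * t) * u)   ∎)
    where open ≡-Reasoning
  2∤u : 2 ∤ u
  2∤u 2∣u = 2∤U₂ (∣-trans 2∣u (m∣m*n (3 ^ t)))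
  3∤u : 3 ∤ u
  3∤u 3∣u = 3∤U₃ (subst (3 ∣_) (sym U₃≡) (∣-trans 3∣u (n∣m*n (2 ^ (2 * t)))))

factorial-12-adic : ∀ n → s 2 n ≡ s 3 n → ∃₂ λ t u → n ! ≡ 12 ^ t * u × 2 ∤ u × 3 ∤ u
factorial-12-adic n s₂≡s₃ with Radix.legendre 0 prime[2] n | Radix.legendre 1 prime[3] n
... | E , U₂ , n!≡2^E*U₂ , 2∤U₂ , legendre₂ | t , U₃ , n!≡3^t*U₃ , 3∤U₃ , legendre₃ =
  t , 12-adic-from-valuations {t = t} (subst (λ e → n ! ≡ 2 ^ e * U₂) E≡2t n!≡2^E*U₂) n!≡3^t*U₃ 2∤U₂ 3∤U₃
  where
  E≡2t : E ≡ 2 * t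
  E≡2t = +-cancelʳ-≡ (s 2 n) E (2 * t) (begin
    E + s 2 n           ≡⟨ cong (_+ s 2 n) (*-identityˡ E) ⟨
    1 * E + s 2 n       ≡⟨ legendre₂ ⟩
    n                   ≡⟨ legendre₃ ⟨
    2 * t + s 3 n       ≡⟨ cong (2 * t +_) s₂≡s₃ ⟨
    2 * t + s 2 n       ∎)
    where open ≡-Reasoning

n<12^n : ∀ n → n < 12 ^ n
n<12^n zero    = z<s
n<12^n (suc n) = ≤-<-trans (n<12^n n) (subst (12 ^ n <_) (*-comm (12 ^ n) 12) (m<m*n (12 ^ n) 12 (s≤s (s≤s z≤n))))
  where instance _ = m^n≢0 12 n

strip12-*12 : ∀ f m → strip12 (suc f) (m * 12) ≡ strip12 f m
strip12-*12 f m = trans (cong (λ x → if x ≡ᵇ 0 then strip12 f (m * 12 / 12) else m * 12) (m*n%n≡0 m 12))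
                         (cong (strip12 f) (m*n/n≡m m 12))

strip12-12^* : ∀ {f} T r → T ≤ f → r % 12 ≢ 0 → strip12 f (12 ^ T * r) ≡ r
strip12-12^* {zero}  zero r _ _ = *-identityˡ r
strip12-12^* {suc f} zero r _ r%12≢0 rewrite *-identityˡ r with r % 12 | r%12≢0
... | zero  | 0≢0 = contradiction refl 0≢0
... | suc _ | _   = refl
strip12-12^* {suc f} (suc T) r (s≤s T≤f) r%12≢0 = begin
  strip12 (suc f) (12 * 12 ^ T * r)   ≡⟨ cong (strip12 (suc f)) (shuffle (12 ^ T) r) ⟩
  strip12 (suc f) (12 ^ T * r * 12)   ≡⟨ strip12-*12 f (12 ^ T * r) ⟩
  strip12 f (12 ^ T * r)              ≡⟨ strip12-12^* T r T≤f r%12≢0 ⟩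
  r                                   ∎
  where
  open ≡-Reasoning
  shuffle : ∀ x r → 12 * x * r ≡ x * r * 12
  shuffle = solve-∀

ℓ12-12^* : ∀ T r → r % 12 ≢ 0 → ℓ12 (12 ^ T * r) ≡ r % 12
ℓ12-12^* T zero    0≢0     = contradiction refl 0≢0
ℓ12-12^* T (suc r) r%12≢0 =
  cong (_% 12) (strip12-12^* T (suc r) (≤-trans (<⇒≤ (n<12^n T)) (m≤m*n (12 ^ T) (suc r))) r%12≢0)
  where instance _ = m^n≢0 12 T

mod-*-cong : ∀ {a a′ b b′} n .{{_ : NonZero n}} → a % n ≡ a′ % n → b % n ≡ b′ % n → (a * b) % n ≡ (a′ * b′) % n
mod-*-cong {a} {a′} {b} {b′} n a≡a′ b≡b′ = begin
  (a * b) % n                   ≡⟨ %-distribˡ-* a b n ⟩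
  ((a % n) * (b % n)) % n       ≡⟨ cong₂ (λ x y → (x * y) % n) a≡a′ b≡b′ ⟩
  ((a′ % n) * (b′ % n)) % n     ≡⟨ %-distribˡ-* a′ b′ n ⟨
  (a′ * b′) % n                 ∎
  where open ≡-Reasoning

-- X = 12^T · d · r with r ≡ ρ·u (mod 12). The factor d is kept exactly, so that powers of 12
-- can still be split off it (shape-12), while r is only known modulo 12.
record Shape (u X T d ρ : ℕ) : Set where
  constructor shape
  field
    cofactor      : ℕ
    factorisation : X ≡ 12 ^ T * (d * cofactor)
    cofactor-mod  : cofactor % 12 ≡ (ρ * u) % 12

shape-* : ∀ {u X T d ρ} q e c m → Shape u X T d ρ →
          Shape u ((e * c + q * (e * m * 12)) * X) T (d * e) (ρ * c)
shape-* {u} {X} {T} {d} {ρ} q e c m (shape r X≡ r≡) = shape ((c + q * m * 12) * r) X′≡ r′≡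
  where
  open ≡-Reasoning
  X′≡ : (e * c + q * (e * m * 12)) * X ≡ 12 ^ T * (d * e * ((c + q * m * 12) * r))
  X′≡ = trans (cong ((e * c + q * (e * m * 12)) *_) X≡) (shuffle e c q m (12 ^ T) d r)
    where
    shuffle : ∀ e c q m P d r → (e * c + q * (e * m * 12)) * (P * (d * r)) ≡ P * (d * e * ((c + q * m * 12) * r))
    shuffle = solve-∀
  r′≡ : ((c + q * m * 12) * r) % 12 ≡ (ρ * c * u) % 12
  r′≡ = begin
    ((c + q * m * 12) * r) % 12   ≡⟨ mod-*-cong {c + q * m * 12} {c} {r} {ρ * u} 12 ([m+kn]%n≡m%n c (q * m) 12) r≡ ⟩
    (c * (ρ * u)) % 12            ≡⟨ cong (_% 12) (shuffle c ρ u) ⟩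
    (ρ * c * u) % 12              ∎
    where
    shuffle : ∀ c ρ u → c * (ρ * u) ≡ ρ * c * u
    shuffle = solve-∀

shape-12 : ∀ {u X T} d {ρ} → Shape u X T (12 * d) ρ → Shape u X (suc T) d ρ
shape-12 {T = T} d (shape r X≡ r≡) = shape r (trans X≡ (shuffle (12 ^ T) d r)) r≡
  where
  shuffle : ∀ P d r → P * (12 * d * r) ≡ 12 * P * (d * r)
  shuffle = solve-∀

ℓ12-shape : ∀ {u X T d ρ} → Shape u X T d ρ → (d * ρ * u) % 12 ≢ 0 → ℓ12 X ≡ (d * ρ * u) % 12
ℓ12-shape {u} {T = T} {d} {ρ} (shape r refl r≡) ≢0 = trans (ℓ12-12^* T (d * r) (≢0 ∘ trans (sym dr≡))) dr≡
  where
  dr≡ : (d * r) % 12 ≡ (d * ρ * u) % 12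
  dr≡ = trans (mod-*-cong {d} {d} {r} {ρ * u} 12 refl r≡) (cong (_% 12) (sym (*-assoc d ρ u)))

-- The pairs (k , k! / 12^v₁₂(k!)).
shifts : List (ℕ × ℕ)
shifts = (1 , 1) ∷ (2 , 2) ∷ (5 , 10) ∷ (6 , 5) ∷ (7 , 35) ∷ (10 , 175) ∷ []

ℓ12-shifted-factorial : ∀ q {t u} → (q * 1728) ! ≡ 12 ^ t * u →
  All (λ (k , c) → (c * u) % 12 ≢ 0 → ℓ12 ((k + q * 1728) !) ≡ (c * u) % 12) shifts
ℓ12-shifted-factorial q {t} {u} N!≡ =
  ℓ12-shape f1 ∷ ℓ12-shape f2 ∷ ℓ12-shape f5 ∷ ℓ12-shape f6 ∷ ℓ12-shape f7 ∷ ℓ12-shape f10 ∷ []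
  where
  N : ℕ
  N = q * 1728
  -- The literal arguments e c m of shape-* make its new factor normalise to j + N = e·(c + 12·m).
  f0 : Shape u (N !) t 1 1
  f0 = shape u (trans N!≡ (cong (12 ^ t *_) (sym (*-identityˡ u)))) (cong (_% 12) (sym (*-identityˡ u)))
  f1 : Shape u ((1 + N) !) t 1 1
  f1 = shape-* q 1 1 144 f0
  f2 : Shape u ((2 + N) !) t 2 1
  f2 = shape-* q 2 1 72 f1
  f4 : Shape u ((4 + N) !) (suc t) 2 1
  f4 = shape-12 2 (shape-* q 4 1 36 (shape-* q 3 1 48 f2))
  f5 : Shape u ((5 + N) !) (suc t) 2 5
  f5 = shape-* q 1 5 144 f4
  f6 : Shape u ((6 + N) !) (2 + t) 1 5
  f6 = shape-12 1 (shape-* q 6 1 24 f5)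
  f7 : Shape u ((7 + N) !) (2 + t) 1 35
  f7 = shape-* q 1 7 144 f6
  f10 : Shape u ((10 + N) !) (4 + t) 1 175
  f10 = shape-12 1 (shape-* q 2 5 72 (shape-12 6 (shape-* q 9 1 16 (shape-* q 8 1 18 f7))))

targets : List ℕ
targets = 1 ∷ 2 ∷ 5 ∷ 7 ∷ 10 ∷ 11 ∷ []

Reaches : ℕ → ℕ → Set
Reaches v d = Any (λ (k , c) → 1 ≤ k × k ≤ 10 × (c * v) % 12 ≢ 0 × (c * v) % 12 ≡ d) shifts

units-reach-targets : ∀ {v} → v < 12 → v % 2 ≢ 0 → v % 3 ≢ 0 → All (Reaches v) targets
units-reach-targets = from-yes (allUpTo? (λ v → ¬? (v % 2 ≟ 0) →-dec ¬? (v % 3 ≟ 0) →-dec all? (reaches? v) targets) 12)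
  where
  reaches? : ∀ v d → Dec (Reaches v d)
  reaches? v d = any? (λ (k , c) → 1 ≤? k ×-dec k ≤? 10 ×-dec ¬? ((c * v) % 12 ≟ 0) ×-dec (c * v) % 12 ≟ d) shifts

∤⇒%12%≢0 : ∀ {u} p .{{_ : NonZero p}} → p ∣ 12 → p ∤ u → (u % 12) % p ≢ 0
∤⇒%12%≢0 {u} p p∣12 p∤u = p∤u ∘ m%n≡0⇒n∣m u p ∘ trans (sym (m∣n⇒o%n%m≡o%m p 12 u p∣12))

digit-reached : ∀ {N u d} → All (λ (k , c) → (c * u) % 12 ≢ 0 → ℓ12 ((k + N) !) ≡ (c * u) % 12) shifts →
                Reaches (u % 12) d → ∃ λ k → 1 ≤ k × k ≤ 10 × ℓ12 ((N + k) !) ≡ d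
digit-reached {N} {u} {d} table reach with find reach
... | (k , c) , kc∈shifts , 1≤k , k≤10 , ≢0 , ≡d = k , 1≤k , k≤10 , (begin
  ℓ12 ((N + k) !)       ≡⟨ cong (ℓ12 ∘ _!) (+-comm N k) ⟩
  ℓ12 ((k + N) !)       ≡⟨ lookup table kc∈shifts (≢0 ∘ trans (sym cu≡)) ⟩
  (c * u) % 12          ≡⟨ cu≡ ⟩
  (c * (u % 12)) % 12   ≡⟨ ≡d ⟩
  d                     ∎)
  where
  open ≡-Reasoning
  cu≡ : (c * u) % 12 ≡ (c * (u % 12)) % 12
  cu≡ = mod-*-cong {c} {c} {u} {u % 12} 12 refl (sym (m%n%n≡m%n u 12))

proposition3p1 : (n : ℕ) → 12 ^ 3 ∣ n → s 2 n ≡ s 3 n →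
    All (λ d → ∃ λ k → 1 ≤ k × k ≤ 10 × ℓ12 ((n + k) !) ≡ d)
        (1 ∷ 2 ∷ 5 ∷ 7 ∷ 10 ∷ 11 ∷ [])
proposition3p1 .(q * 12 ^ 3) (divides q refl) s₂≡s₃ with factorial-12-adic (q * 12 ^ 3) s₂≡s₃
... | t , u , n!≡12^t*u , 2∤u , 3∤u =
  All-map (digit-reached {u = u} (ℓ12-shifted-factorial q {t} {u} n!≡12^t*u))
          (units-reach-targets (m%n<n u 12) (∤⇒%12%≢0 2 (divides 6 refl) 2∤u) (∤⇒%12%≢0 3 (divides 4 refl) 3∤u))
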